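{- Let $q$ be a prime power, $r$ a positive integer, $d$ a positive divisor of $q+1$, $\epsilon\in\mathbb F_{q^2}^*$ an element of order $d$, and for $0\le k<d$ let $A_k=\{x\in\mu_{q+1}:x^{(q+1)/d}=\epsilon^k\}$. Let $h(X)\in\mathbb F_{q^2}[X]$ with $\deg h\le q$. Assume that for every $0\le k<d$ there exist an integer $e_k$, an element $\lambda_k\in\mu_{q+1}$ and $\pi(k)\in\mathbb Z/d\mathbb Z$ with $\lambda_k\in A_{\pi(k)}$ (i.e. $\lambda_k^{(q+1)/d}=\epsilon^{\pi(k)}$) such that $$x^rh(x)^{q-1}=\lambda_kx^{e_k}\quad\text{for all }x\in A_k.$$ Then $X^rh(X)^{q-1}$ permutes $\mu_{q+1}$ if and only if $\gcd(e_k,(q+1)/d)=1$ for all $0\le k<d$ and the map $k\mapsto \pi(k)+e_kk$ is a permutation of $\mathbb Z/d\mathbb Z$.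
   Context: $\mu_{q+1}=\{x\in\mathbb F_{q^2}^*:x^{q+1}=1\}$. The sets $A_0,\dots,A_{d-1}$ are the cosets of $\mu_{(q+1)/d}$ in $\mu_{q+1}$; the index $k$ of $A_k$ is read modulo $d$. -}

module Defs where

open import Level using (Level; _⊔_)
open import Algebra.Bundles using (CommutativeRing)
open import Data.Nat using (ℕ; zero; suc; _<_; _≡ᵇ_; NonZero)
import Data.Nat as ℕ
open import Data.Nat.Primality using (Prime)
open import Data.Integer using (ℤ; +_; -[1+_])
import Data.Integer as ℤ
open import Data.Integer.DivMod using (_%ℕ_; n%ℕd<d)
open import Data.Fin using (Fin; fromℕ<)
open import Data.Vec using (Vec; []; _∷_)
open import Data.Product using (Σ; ∃; _×_; _,_)
open import Function.Bundles using (_↔_)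
open import Relation.Binary.PropositionalEquality using (_≡_)
open import Relation.Nullary using (¬_)

IsPrimePower : ℕ → Set
IsPrimePower q = Σ ℕ λ p → Σ ℕ λ k → Prime p × q ≡ p ℕ.^ suc k

modFin : ℤ → (d : ℕ) → .{{_ : NonZero d}} → Fin d
modFin i d = fromℕ< (n%ℕd<d i d)

module _ {c ℓ : Level} (R : CommutativeRing c ℓ) where
  open CommutativeRing R

  record IsField : Set (c ⊔ ℓ) where
    field
      inv     : Carrier → Carrier
      1≉0     : ¬ (1# ≈ 0#)
      inverse : ∀ x → ¬ (x ≈ 0#) → x * inv x ≈ 1#

  HasCard : ℕ → Set (c ⊔ ℓ)
  HasCard n = Σ (Fin n → Carrier) λ f →
                (∀ i j → f i ≈ f j → i ≡ j) × (∀ x → ∃ λ i → f i ≈ x)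

  pow : Carrier → ℕ → Carrier
  pow x zero    = 1#
  pow x (suc n) = x * pow x n

  zpow : IsField → Carrier → ℤ → Carrier
  zpow F x (+ n)     = pow x n
  zpow F x -[1+ n ]  = pow (IsField.inv F x) (suc n)

  eval : {n : ℕ} → Vec Carrier n → Carrier → Carrier
  eval []       x = 0#
  eval (a ∷ as) x = a + x * eval as x

  HasOrder : Carrier → ℕ → Set ℓ
  HasOrder ε d = (pow ε d ≈ 1#) × (∀ j → 0 < j → j < d → ¬ (pow ε j ≈ 1#))

  InMu : ℕ → Carrier → Set ℓ
  InMu q x = pow x (suc q) ≈ 1#

  Permutes : ℕ → (Carrier → Carrier) → Set (c ⊔ ℓ)
  Permutes q f = (∀ x → InMu q x → InMu q (f x))
               × (∀ x y → InMu q x → InMu q y → f x ≈ f y → x ≈ y)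
               × (∀ y → InMu q y → ∃ λ x → InMu q x × f x ≈ y)

module Submission where

-- Write m = (q+1)/d, so that A_k = {x ∈ μ_{q+1} : xᵐ = εᵏ}. On A_k the map f is x ↦ λₖx^{eₖ};
-- raising to the m-th power shows that f sends A_k into A_{π(k)+eₖk}. The restriction of f to
-- A_k is injective iff gcd(eₖ, m) = 1: Bézout gives one direction, and a nontrivial root z of
-- X^{gcd(eₖ,m)} − 1 gives f(az) = f(a) for a ∈ A_k in the other. Hence f is injective on μ_{q+1}
-- iff all these restrictions are injective and k ↦ π(k) + eₖk is injective, and finiteness turns
-- injectivity into bijectivity on both sides. The facts needed about the field with q² elements
-- (Fermat's little theorem, existence of enough roots of unity, every d-th root of unity being a
-- power of ε) all come from counting: a polynomial of degree D has at most D roots.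

open import Defs
open import Level using (Level; _⊔_)
open import Algebra.Bundles using (CommutativeRing)
import Algebra.Properties.CommutativeSemiring.Exp
open import Data.Empty using (⊥-elim)
open import Data.Fin as Fin using (Fin; zero; suc; toℕ)
import Data.Fin.Properties as Fin
open import Data.Fin.Permutation using (Permutation)
open import Data.Integer as ℤ using (ℤ; +_; -[1+_]; 1ℤ)
import Data.Integer.Properties as ℤ
open import Data.Integer.DivMod using (_%ℕ_; _/ℕ_; a≡a%ℕn+[a/ℕn]*n)
open import Data.Integer.Divisibility.Signed as ℤ∣ using (divides)
open import Data.Integer.GCD using (gcd)
open import Data.Integer.Tactic.RingSolver using (solve-∀)
open import Data.Maybe using (nothing)
open import Data.Nat as ℕ using (ℕ; zero; suc; _∸_; _/_; _≤_; _<_; z≤n; s≤s; NonZero)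
import Data.Nat.Properties as ℕ
open import Data.Nat.DivMod using (m/n*n≡m)
open import Data.Nat.Divisibility using (_∣_; divides; ∣-trans)
import Data.Nat.GCD as ℕ
open import Data.Nat.Tactic.RingSolver using () renaming (solve-∀ to solveℕ-∀)
open import Data.Product using (Σ; ∃; _×_; _,_; proj₁; proj₂; map)
open import Data.Sum using (_⊎_; inj₁; inj₂)
open import Data.Vec using (Vec; []; _∷_)
open import Function using (_∘_; id)
open import Function.Bundles using (_⇔_; mk⇔; mk↔ₛ′)
open import Function.Consequences.Propositional using (strictlySurjective⇒surjective)
open import Function.Definitions using (Injective; StrictlySurjective; Bijective)
open import Relation.Binary.Definitions using (tri<; tri≈; tri>) renaming (Decidable to Decidable₂)
open import Relation.Binary.PropositionalEquality as ≡ using (_≡_; _≢_)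
open import Relation.Nullary using (¬_; yes; no)
open import Relation.Unary using (Pred; Decidable; _⊆_; _∪_)
open import Relation.Unary.Properties using (_∪?_; _∩?_; ∁?)
open import Tactic.RingSolver.Core.AlmostCommutativeRing using (fromCommutativeRing)
import Tactic.RingSolver.NonReflective as NonReflective

Fin-injective⇒surjective : ∀ {n} (f : Fin n → Fin n) →
                           Injective _≡_ _≡_ f → StrictlySurjective _≡_ f
Fin-injective⇒surjective f inj y with Fin.any? (λ x → f x Fin.≟ y)
... | yes hit = hit
Fin-injective⇒surjective {suc n} f inj y | no miss =
  ⊥-elim (ℕ.<-irrefl ≡.refl (Fin.injective⇒≤ skip-y-injective))
  where
  y≢f : ∀ x → y ≢ f x
  y≢f x y≡fx = miss (x , ≡.sym y≡fx)
  skip-y : Fin (suc n) → Fin n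
  skip-y x = Fin.punchOut (y≢f x)
  skip-y-injective : Injective _≡_ _≡_ skip-y
  skip-y-injective {x} {x′} = inj ∘ Fin.punchOut-injective (y≢f x) (y≢f x′)

Fin-surjective⇒injective : ∀ {n} (f : Fin n → Fin n) →
                           StrictlySurjective _≡_ f → Injective _≡_ _≡_ f
Fin-surjective⇒injective f surj {x} {x′} fx≡fx′ = begin
  x               ≡⟨ section∘f x ⟨
  section (f x)   ≡⟨ ≡.cong section fx≡fx′ ⟩
  section (f x′)  ≡⟨ section∘f x′ ⟩
  x′              ∎
  where
  open ≡.≡-Reasoning
  section : Fin _ → Fin _
  section y = proj₁ (surj y)
  f∘section : ∀ y → f (section y) ≡ y
  f∘section y = proj₂ (surj y)
  section-injective : Injective _≡_ _≡_ section
  section-injective {y} {y′} eq =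
    ≡.trans (≡.sym (f∘section y)) (≡.trans (≡.cong f eq) (f∘section y′))
  section∘f : ∀ x → section (f x) ≡ x
  section∘f x with y , ≡.refl ← Fin-injective⇒surjective section section-injective x =
    ≡.cong section (f∘section y)

-- Counting

module _ {a} {A : Set a} where

  count : ∀ {p} {P : Pred A p} → Decidable P → ∀ {s} → (Fin s → A) → ℕ
  count P? {zero}  f = 0
  count P? {suc s} f with P? (f zero)
  ... | yes _ = suc (count P? (f ∘ suc))
  ... | no  _ = count P? (f ∘ suc)

  module _ {p} {P : Pred A p} (P? : Decidable P) where

    count-none : ∀ {s} (f : Fin s → A) → (∀ i → ¬ P (f i)) → count P? f ≡ 0
    count-none {zero}  f none = ≡.refl
    count-none {suc s} f none with P? (f zero)
    ... | yes p = ⊥-elim (none zero p)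
    ... | no  _ = count-none (f ∘ suc) (none ∘ suc)

    count-all : ∀ {s} (f : Fin s → A) → (∀ i → P (f i)) → count P? f ≡ s
    count-all {zero}  f all = ≡.refl
    count-all {suc s} f all with P? (f zero)
    ... | yes _ = ≡.cong suc (count-all (f ∘ suc) (all ∘ suc))
    ... | no ¬p = ⊥-elim (¬p (all zero))

    0<count⇒∃ : ∀ {s} (f : Fin s → A) → 0 < count P? f → ∃ λ i → P (f i)
    0<count⇒∃ {suc s} f pos with P? (f zero)
    ... | yes p = zero , p
    ... | no  _ with i , p ← 0<count⇒∃ (f ∘ suc) pos = suc i , p

    ∃⇒0<count : ∀ {s} (f : Fin s → A) i → P (f i) → 0 < count P? f
    ∃⇒0<count {suc s} f i p with P? (f zero)
    ∃⇒0<count {suc s} f i       p | yes _  = s≤s z≤n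
    ∃⇒0<count {suc s} f zero    p | no  ¬p = ⊥-elim (¬p p)
    ∃⇒0<count {suc s} f (suc i) p | no  _  = ∃⇒0<count (f ∘ suc) i p

    count-complement : ∀ {s} (f : Fin s → A) → count P? f ℕ.+ count (∁? P?) f ≡ s
    count-complement {zero}  f = ≡.refl
    count-complement {suc s} f with P? (f zero)
    ... | yes _ = ≡.cong suc (count-complement (f ∘ suc))
    ... | no  _ = ≡.trans (ℕ.+-suc _ _) (≡.cong suc (count-complement (f ∘ suc)))

    module _ {q} {Q : Pred A q} (Q? : Decidable Q) where

      count-mono : ∀ {s} (f : Fin s → A) → P ⊆ Q → count P? f ≤ count Q? f
      count-mono {zero}  f P⊆Q = z≤n
      count-mono {suc s} f P⊆Q with P? (f zero) | Q? (f zero)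
      ... | yes _ | yes _ = s≤s (count-mono (f ∘ suc) P⊆Q)
      ... | yes p | no ¬q = ⊥-elim (¬q (P⊆Q p))
      ... | no  _ | yes _ = ℕ.m≤n⇒m≤1+n (count-mono (f ∘ suc) P⊆Q)
      ... | no  _ | no  _ = count-mono (f ∘ suc) P⊆Q

      count-∪ : ∀ {s} (f : Fin s → A) → count (P? ∪? Q?) f ≤ count P? f ℕ.+ count Q? f
      count-∪ {zero}  f = z≤n
      count-∪ {suc s} f with P? (f zero) | Q? (f zero)
      ... | yes _ | yes _ = s≤s (ℕ.≤-trans (count-∪ (f ∘ suc))
                                   (ℕ.≤-trans (ℕ.n≤1+n _) (ℕ.≤-reflexive (≡.sym (ℕ.+-suc _ _)))))
      ... | yes _ | no  _ = s≤s (count-∪ (f ∘ suc))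
      ... | no  _ | yes _ = ℕ.≤-trans (s≤s (count-∪ (f ∘ suc))) (ℕ.≤-reflexive (≡.sym (ℕ.+-suc _ _)))
      ... | no  _ | no  _ = count-∪ (f ∘ suc)

  count-⊆∪ : ∀ {p q r} {P : Pred A p} {Q : Pred A q} {R : Pred A r}
             (P? : Decidable P) (Q? : Decidable Q) (R? : Decidable R) →
             ∀ {s} (f : Fin s → A) → P ⊆ Q ∪ R → count P? f ≤ count Q? f ℕ.+ count R? f
  count-⊆∪ P? Q? R? f P⊆Q∪R = ℕ.≤-trans (count-mono P? (Q? ∪? R?) f P⊆Q∪R) (count-∪ Q? R? f)

-- Congruences of integers

module _ where
  open import Data.Integer using (_+_; _-_; _*_; -_)
  open ≡.≡-Reasoning

  infix 4 _≡_mod_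
  record _≡_mod_ (a b : ℤ) (t : ℕ) : Set where
    constructor congruent
    field difference : + t ℤ∣.∣ a - b

  mod-trans : ∀ {t a b c} → a ≡ b mod t → b ≡ c mod t → a ≡ c mod t
  mod-trans {t} {a} {b} {c} (congruent t∣a-b) (congruent t∣b-c) =
    congruent (≡.subst (+ t ℤ∣.∣_) (telescope a b c) (ℤ∣.∣m∣n⇒∣m+n t∣a-b t∣b-c))
    where
    telescope : ∀ a b c → (a - b) + (b - c) ≡ a - c
    telescope = solve-∀

  mod-divisor : ∀ {t u a b} → t ∣ u → a ≡ b mod u → a ≡ b mod t
  mod-divisor t∣u (congruent u∣a-b) = congruent (ℤ∣.∣-trans (ℤ∣.∣ᵤ⇒∣ t∣u) u∣a-b)

  %ℕ-mod : ∀ z t .{{_ : NonZero t}} → z ≡ + (z %ℕ t) mod t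
  %ℕ-mod z t = congruent (divides (z /ℕ t) (begin
    z - r                 ≡⟨ ≡.cong (_- r) (a≡a%ℕn+[a/ℕn]*n z t) ⟩
    r + z /ℕ t * + t - r  ≡⟨ cancel r (z /ℕ t * + t) ⟩
    z /ℕ t * + t          ∎))
    where
    r : ℤ
    r = + (z %ℕ t)
    cancel : ∀ r x → r + x - r ≡ x
    cancel = solve-∀

  mod-affine : ∀ {t e E} p k → e ≡ E mod t → p + k * E ≡ p + e * k mod t
  mod-affine {t} {e} {E} p k (congruent (divides w e-E≡wt)) = congruent (divides (- (k * w)) (begin
    (p + k * E) - (p + e * k)  ≡⟨ regroup p k e E ⟩
    - (k * (e - E))            ≡⟨ ≡.cong (λ v → - (k * v)) e-E≡wt ⟩
    - (k * (w * + t))          ≡⟨ reassoc k w (+ t) ⟩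
    - (k * w) * + t            ∎))
    where
    regroup : ∀ p k e E → (p + k * E) - (p + e * k) ≡ - (k * (e - E))
    regroup = solve-∀
    reassoc : ∀ k w t → - (k * (w * t)) ≡ - (k * w) * t
    reassoc = solve-∀

  -a≡b⇒a+b≡0 : ∀ {t} a b → - a ≡ b mod t → a + b ≡ + 0 mod t
  -a≡b⇒a+b≡0 {t} a b (congruent (divides w -a-b≡wt)) = congruent (divides (- w) (begin
    a + b - + 0        ≡⟨ negate a b ⟩
    - (- a - b)        ≡⟨ ≡.cong -_ -a-b≡wt ⟩
    - (w * + t)        ≡⟨ ℤ.neg-distribˡ-* w (+ t) ⟩
    - w * + t          ∎))
    where
    negate : ∀ a b → a + b - + 0 ≡ - (- a - b)
    negate = solve-∀

  mod⇒offset : ∀ {t a b} → + a ≡ + b mod t →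
               (∃ λ u → a ≡ b ℕ.+ u ℕ.* t) ⊎ (∃ λ u → b ≡ a ℕ.+ u ℕ.* t)
  mod⇒offset {t} {a} {b} (congruent (divides (+ u) a-b≡ut)) = inj₁ (u , ℤ.+-injective (begin
    + a                  ≡⟨ split (+ a) (+ b) ⟩
    + b + (+ a - + b)    ≡⟨ ≡.cong (λ v → + b + v) a-b≡ut ⟩
    + b + + u * + t      ≡⟨ ≡.cong (λ v → + b + v) (ℤ.pos-* u t) ⟨
    + b + + (u ℕ.* t)    ≡⟨ ℤ.pos-+ b (u ℕ.* t) ⟨
    + (b ℕ.+ u ℕ.* t)    ∎))
    where
    split : ∀ a b → a ≡ b + (a - b)
    split = solve-∀
  mod⇒offset {t} {a} {b} (congruent (divides -[1+ u ] a-b≡-ut)) = inj₂ (suc u , ℤ.+-injective (begin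
    + b                      ≡⟨ split (+ a) (+ b) ⟩
    + a - (+ a - + b)        ≡⟨ ≡.cong (λ v → + a - v) a-b≡-ut ⟩
    + a - -[1+ u ] * + t     ≡⟨ negate (+ a) -[1+ u ] (+ t) ⟩
    + a + + suc u * + t      ≡⟨ ≡.cong (λ v → + a + v) (ℤ.pos-* (suc u) t) ⟨
    + a + + (suc u ℕ.* t)    ≡⟨ ℤ.pos-+ a (suc u ℕ.* t) ⟨
    + (a ℕ.+ suc u ℕ.* t)    ∎))
    where
    split : ∀ a b → b ≡ a - (a - b)
    split = solve-∀
    negate : ∀ a w t → a - w * t ≡ a + (- w) * t
    negate = solve-∀

-- Powers in a field

module Field {c ℓ : Level} (R : CommutativeRing c ℓ) (F : IsField R) where

  open CommutativeRing R hiding (zero)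
  open IsField F
  open import Relation.Binary.Reasoning.Setoid setoid
  private module Exp = Algebra.Properties.CommutativeSemiring.Exp commutativeSemiring
  open NonReflective (fromCommutativeRing R (λ _ → nothing)) using (solve; _⊜_; _⊕_; _⊗_)
  open import Algebra.Properties.CommutativeSemigroup *-commutativeSemigroup using (interchange; x∙yz≈y∙xz)
  open import Algebra.Properties.Group +-group using () renaming (∙-cancelʳ to +-cancelʳ)

  infixr 8 _^_ _^ℤ_

  _^_ : Carrier → ℕ → Carrier
  _^_ = pow R

  _^ℤ_ : Carrier → ℤ → Carrier
  _^ℤ_ = zpow R F

  ^≡Exp^ : ∀ x n → x ^ n ≡ x Exp.^ n
  ^≡Exp^ x zero    = ≡.refl
  ^≡Exp^ x (suc n) = ≡.cong (x *_) (^≡Exp^ x n)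

  ^-congˡ : ∀ {x y} n → x ≈ y → x ^ n ≈ y ^ n
  ^-congˡ {x} {y} n x≈y rewrite ^≡Exp^ x n | ^≡Exp^ y n = Exp.^-congˡ n x≈y

  ^-congʳ : ∀ x {m n} → m ≡ n → x ^ m ≈ x ^ n
  ^-congʳ x m≡n = reflexive (≡.cong (x ^_) m≡n)

  ^-homo-* : ∀ x m n → x ^ (m ℕ.+ n) ≈ x ^ m * x ^ n
  ^-homo-* x m n rewrite ^≡Exp^ x (m ℕ.+ n) | ^≡Exp^ x m | ^≡Exp^ x n = Exp.^-homo-* x m n

  ^-assocʳ : ∀ x m n → (x ^ m) ^ n ≈ x ^ (m ℕ.* n)
  ^-assocʳ x m n rewrite ^≡Exp^ (x ^ m) n | ^≡Exp^ x m | ^≡Exp^ x (m ℕ.* n) = Exp.^-assocʳ x m n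

  ^-distrib-* : ∀ x y n → (x * y) ^ n ≈ x ^ n * y ^ n
  ^-distrib-* x y n rewrite ^≡Exp^ (x * y) n | ^≡Exp^ x n | ^≡Exp^ y n = Exp.^-distrib-* x y n

  1^n≈1 : ∀ n → 1# ^ n ≈ 1#
  1^n≈1 zero    = refl
  1^n≈1 (suc n) = trans (*-identityˡ _) (1^n≈1 n)

  ^-comm : ∀ x m n → (x ^ m) ^ n ≈ (x ^ n) ^ m
  ^-comm x m n = begin
    (x ^ m) ^ n   ≈⟨ ^-assocʳ x m n ⟩
    x ^ (m ℕ.* n) ≡⟨ ≡.cong (x ^_) (ℕ.*-comm m n) ⟩
    x ^ (n ℕ.* m) ≈⟨ ^-assocʳ x n m ⟨
    (x ^ n) ^ m   ∎

  ^≈1⇒^-multiple≈1 : ∀ {x n t} → x ^ n ≈ 1# → n ∣ t → x ^ t ≈ 1#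
  ^≈1⇒^-multiple≈1 {x} {n} {t} xⁿ≈1 (divides w t≡wn) = begin
    x ^ t          ≡⟨ ≡.cong (x ^_) (≡.trans t≡wn (ℕ.*-comm w n)) ⟩
    x ^ (n ℕ.* w)  ≈⟨ ^-assocʳ x n w ⟨
    (x ^ n) ^ w    ≈⟨ ^-congˡ w xⁿ≈1 ⟩
    1# ^ w         ≈⟨ 1^n≈1 w ⟩
    1#             ∎

  inverseˡ : ∀ x → ¬ x ≈ 0# → inv x * x ≈ 1#
  inverseˡ x x≉0 = trans (*-comm _ _) (inverse x x≉0)

  *-cancelˡ : ∀ {a x y} → ¬ a ≈ 0# → a * x ≈ a * y → x ≈ y
  *-cancelˡ {a} {x} {y} a≉0 ax≈ay = begin
    x                ≈⟨ *-identityˡ x ⟨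
    1# * x           ≈⟨ *-congʳ (inverseˡ a a≉0) ⟨
    (inv a * a) * x  ≈⟨ *-assoc _ _ _ ⟩
    inv a * (a * x)  ≈⟨ *-congˡ ax≈ay ⟩
    inv a * (a * y)  ≈⟨ *-assoc _ _ _ ⟨
    (inv a * a) * y  ≈⟨ *-congʳ (inverseˡ a a≉0) ⟩
    1# * y           ≈⟨ *-identityˡ y ⟩
    y                ∎

  *-cancelʳ : ∀ {a x y} → ¬ a ≈ 0# → x * a ≈ y * a → x ≈ y
  *-cancelʳ a≉0 xa≈ya = *-cancelˡ a≉0 (trans (*-comm _ _) (trans xa≈ya (*-comm _ _)))

  *-nonzero : ∀ {x y} → ¬ x ≈ 0# → ¬ y ≈ 0# → ¬ x * y ≈ 0#
  *-nonzero {x} x≉0 y≉0 xy≈0 = y≉0 (*-cancelˡ x≉0 (trans xy≈0 (sym (zeroʳ x))))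

  ^-nonzero : ∀ {x} n → ¬ x ≈ 0# → ¬ x ^ n ≈ 0#
  ^-nonzero zero    x≉0 = 1≉0
  ^-nonzero (suc n) x≉0 = *-nonzero x≉0 (^-nonzero n x≉0)

  root-of-unity-nonzero : ∀ {x} n .{{_ : NonZero n}} → x ^ n ≈ 1# → ¬ x ≈ 0#
  root-of-unity-nonzero (suc n) xⁿ≈1 x≈0 = 1≉0 (trans (sym xⁿ≈1) (trans (*-congʳ x≈0) (zeroˡ _)))

  inverse-unique : ∀ {a b b′} → a * b ≈ 1# → a * b′ ≈ 1# → b ≈ b′
  inverse-unique ab≈1 ab′≈1 =
    *-cancelˡ (λ a≈0 → 1≉0 (trans (sym ab≈1) (trans (*-congʳ a≈0) (zeroˡ _)))) (trans ab≈1 (sym ab′≈1))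

  inv-^-inverse : ∀ x n → ¬ x ≈ 0# → inv x ^ n * x ^ n ≈ 1#
  inv-^-inverse x n x≉0 = begin
    inv x ^ n * x ^ n ≈⟨ ^-distrib-* (inv x) x n ⟨
    (inv x * x) ^ n   ≈⟨ ^-congˡ n (inverseˡ x x≉0) ⟩
    1# ^ n            ≈⟨ 1^n≈1 n ⟩
    1#                ∎

  inv-distrib-* : ∀ {a b} → ¬ a ≈ 0# → ¬ b ≈ 0# → inv (a * b) ≈ inv a * inv b
  inv-distrib-* {a} {b} a≉0 b≉0 = inverse-unique (inverse (a * b) (*-nonzero a≉0 b≉0)) (begin
    (a * b) * (inv a * inv b)  ≈⟨ *-assoc _ _ _ ⟩
    a * (b * (inv a * inv b))  ≈⟨ *-congˡ (x∙yz≈y∙xz b (inv a) (inv b)) ⟩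
    a * (inv a * (b * inv b))  ≈⟨ *-assoc _ _ _ ⟨
    (a * inv a) * (b * inv b)  ≈⟨ *-cong (inverse a a≉0) (inverse b b≉0) ⟩
    1# * 1#                    ≈⟨ *-identityˡ 1# ⟩
    1#                         ∎)

  ^ℤ-distrib-* : ∀ {a b} → ¬ a ≈ 0# → ¬ b ≈ 0# → ∀ z → (a * b) ^ℤ z ≈ a ^ℤ z * b ^ℤ z
  ^ℤ-distrib-* {a} {b} a≉0 b≉0 (+ n)     = ^-distrib-* a b n
  ^ℤ-distrib-* {a} {b} a≉0 b≉0 -[1+ n ] =
    trans (^-congˡ (suc n) (inv-distrib-* a≉0 b≉0)) (^-distrib-* (inv a) (inv b) (suc n))

  ^ℤ≈⇒^∣∣≈ : ∀ {x y} → ¬ x ≈ 0# → ¬ y ≈ 0# → ∀ z →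
             x ^ℤ z ≈ y ^ℤ z → x ^ ℤ.∣ z ∣ ≈ y ^ ℤ.∣ z ∣
  ^ℤ≈⇒^∣∣≈ x≉0 y≉0 (+ n)     xᶻ≈yᶻ = xᶻ≈yᶻ
  ^ℤ≈⇒^∣∣≈ {x} {y} x≉0 y≉0 -[1+ n ] xᶻ≈yᶻ =
    inverse-unique (trans (*-congʳ (sym xᶻ≈yᶻ)) (inv-^-inverse x (suc n) x≉0))
                   (inv-^-inverse y (suc n) y≉0)

  ^∣∣≈1⇒^ℤ≈1 : ∀ {x} → ¬ x ≈ 0# → ∀ z → x ^ ℤ.∣ z ∣ ≈ 1# → x ^ℤ z ≈ 1#
  ^∣∣≈1⇒^ℤ≈1 x≉0 (+ n)     xⁿ≈1 = xⁿ≈1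
  ^∣∣≈1⇒^ℤ≈1 {x} x≉0 -[1+ n ] xⁿ≈1 =
    trans (sym (*-identityʳ _)) (trans (*-congˡ (sym xⁿ≈1)) (inv-^-inverse x (suc n) x≉0))

  module _ {y t} (yᵗ≈1 : y ^ t ≈ 1#) where

    ^-+-multiple : ∀ b u → y ^ (b ℕ.+ u ℕ.* t) ≈ y ^ b
    ^-+-multiple b u = begin
      y ^ (b ℕ.+ u ℕ.* t)     ≈⟨ ^-homo-* y b (u ℕ.* t) ⟩
      y ^ b * y ^ (u ℕ.* t)   ≈⟨ *-congˡ (^≈1⇒^-multiple≈1 {y} {t} yᵗ≈1 (divides u ≡.refl)) ⟩
      y ^ b * 1#              ≈⟨ *-identityʳ _ ⟩
      y ^ b                   ∎

    ^-cong-mod : ∀ a b → + a ≡ + b mod t → y ^ a ≈ y ^ b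
    ^-cong-mod a b a≡b with mod⇒offset a≡b
    ... | inj₁ (u , a≡b+ut) = trans (^-congʳ y a≡b+ut) (^-+-multiple b u)
    ... | inj₂ (u , b≡a+ut) = sym (trans (^-congʳ y b≡a+ut) (^-+-multiple a u))

    ^ℤ-mod : ¬ y ≈ 0# → ∀ {z b} → z ≡ + b mod t → y ^ℤ z ≈ y ^ b
    ^ℤ-mod y≉0 {+ a} {b} a≡b = ^-cong-mod a b a≡b
    ^ℤ-mod y≉0 { -[1+ a ]} {b} -a≡b = begin
      inv y ^ suc a                          ≈⟨ *-identityʳ _ ⟨
      inv y ^ suc a * 1#                     ≈⟨ *-congˡ yᵃ⁺ᵇ≈1 ⟨
      inv y ^ suc a * y ^ (suc a ℕ.+ b)      ≈⟨ *-congˡ (^-homo-* y (suc a) b) ⟩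
      inv y ^ suc a * (y ^ suc a * y ^ b)    ≈⟨ *-assoc _ _ _ ⟨
      (inv y ^ suc a * y ^ suc a) * y ^ b    ≈⟨ *-congʳ (inv-^-inverse y (suc a) y≉0) ⟩
      1# * y ^ b                             ≈⟨ *-identityˡ _ ⟩
      y ^ b                                  ∎
      where
      yᵃ⁺ᵇ≈1 : y ^ (suc a ℕ.+ b) ≈ 1#
      yᵃ⁺ᵇ≈1 = ^-cong-mod (suc a ℕ.+ b) 0 (≡.subst (λ v → v ≡ + 0 mod t) (≡.sym (ℤ.pos-+ (suc a) b))
                                   (-a≡b⇒a+b≡0 (+ suc a) (+ b) -a≡b))

  ^-cong-* : ∀ {x y} a u → x ^ a ≈ y ^ a → x ^ (a ℕ.* u) ≈ y ^ (a ℕ.* u)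
  ^-cong-* {x} {y} a u xᵃ≈yᵃ = begin
    x ^ (a ℕ.* u)  ≈⟨ ^-assocʳ x a u ⟨
    (x ^ a) ^ u    ≈⟨ ^-congˡ u xᵃ≈yᵃ ⟩
    (y ^ a) ^ u    ≈⟨ ^-assocʳ y a u ⟩
    y ^ (a ℕ.* u)  ∎

  ^-≈-bezout⇒≈ : ∀ {x y} a b u v → ¬ x ≈ 0# → suc (v ℕ.* b) ≡ u ℕ.* a →
                 x ^ a ≈ y ^ a → x ^ b ≈ y ^ b → x ≈ y
  ^-≈-bezout⇒≈ {x} {y} a b u v x≉0 1+vb≡ua xᵃ≈yᵃ xᵇ≈yᵇ =
    *-cancelʳ (^-nonzero (v ℕ.* b) x≉0) (begin
      x * x ^ (v ℕ.* b)  ≡⟨ ≡.cong (x ^_) 1+vb≡ua ⟩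
      x ^ (u ℕ.* a)      ≡⟨ ≡.cong (x ^_) (ℕ.*-comm u a) ⟩
      x ^ (a ℕ.* u)      ≈⟨ ^-cong-* a u xᵃ≈yᵃ ⟩
      y ^ (a ℕ.* u)      ≡⟨ ≡.cong (y ^_) (≡.trans (ℕ.*-comm a u) (≡.sym 1+vb≡ua)) ⟩
      y * y ^ (v ℕ.* b)  ≡⟨ ≡.cong (λ n → y * y ^ n) (ℕ.*-comm v b) ⟩
      y * y ^ (b ℕ.* v)  ≈⟨ *-congˡ (^-cong-* b v xᵇ≈yᵇ) ⟨
      y * x ^ (b ℕ.* v)  ≡⟨ ≡.cong (λ n → y * x ^ n) (ℕ.*-comm b v) ⟩
      y * x ^ (v ℕ.* b)  ∎)

  ^-≈-coprime⇒≈ : ∀ {x y} a b → ¬ x ≈ 0# → x ^ a ≈ y ^ a → x ^ b ≈ y ^ b → ℕ.gcd a b ≡ 1 → x ≈ y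
  ^-≈-coprime⇒≈ a b x≉0 xᵃ≈yᵃ xᵇ≈yᵇ gcd≡1 with ℕ.Bézout.identity (ℕ.gcd-GCD a b)
  ... | ℕ.Bézout.+- u v eq =
    ^-≈-bezout⇒≈ a b u v x≉0 (≡.subst (λ g → g ℕ.+ v ℕ.* b ≡ u ℕ.* a) gcd≡1 eq) xᵃ≈yᵃ xᵇ≈yᵇ
  ... | ℕ.Bézout.-+ u v eq =
    ^-≈-bezout⇒≈ b a v u x≉0 (≡.subst (λ g → g ℕ.+ u ℕ.* a ≡ v ℕ.* b) gcd≡1 eq) xᵇ≈yᵇ xᵃ≈yᵃ

  -- Polynomial functions and their roots

  leading : ∀ {n} → Vec Carrier (suc n) → Carrier
  leading (a ∷ [])     = a
  leading (a ∷ b ∷ as) = leading (b ∷ as)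

  quotient : ∀ {n} → Vec Carrier (suc n) → Carrier → Vec Carrier n
  quotient (c ∷ [])     a = []
  quotient (c ∷ b ∷ as) a = eval R (b ∷ as) a ∷ quotient (b ∷ as) a

  -- p(x) − p(a) = (x − a) q(x), arranged without subtraction.
  quotient-correct : ∀ {n} (p : Vec Carrier (suc n)) a x →
                     eval R p x + a * eval R (quotient p a) x ≈ eval R p a + x * eval R (quotient p a) x
  quotient-correct (c ∷ [])     a x =
    solve 4 (λ c x a z → ((c ⊕ x ⊗ z) ⊕ a ⊗ z) ⊜ ((c ⊕ a ⊗ z) ⊕ x ⊗ z)) refl c x a 0#
  quotient-correct (c ∷ b ∷ as) a x = begin
    (c + x * p₁x) + a * (p₁a + x * qx)  ≈⟨ regroup c x a p₁x p₁a qx ⟩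
    (c + a * p₁a) + x * (p₁x + a * qx)  ≈⟨ +-congˡ (*-congˡ (quotient-correct (b ∷ as) a x)) ⟩
    (c + a * p₁a) + x * (p₁a + x * qx)  ∎
    where
    p₁x p₁a qx : Carrier
    p₁x = eval R (b ∷ as) x
    p₁a = eval R (b ∷ as) a
    qx  = eval R (quotient (b ∷ as) a) x
    regroup : ∀ c x a p q r → (c + x * p) + a * (q + x * r) ≈ (c + a * q) + x * (p + a * r)
    regroup = solve 6 (λ c x a p q r → ((c ⊕ x ⊗ p) ⊕ a ⊗ (q ⊕ x ⊗ r)) ⊜ ((c ⊕ a ⊗ q) ⊕ x ⊗ (p ⊕ a ⊗ r))) refl

  leading-quotient : ∀ {n} (p : Vec Carrier (suc (suc n))) a → leading (quotient p a) ≈ leading p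
  leading-quotient (c ∷ b ∷ [])     a = trans (+-congˡ (zeroʳ a)) (+-identityʳ b)
  leading-quotient (c ∷ b ∷ b′ ∷ as) a = leading-quotient (b ∷ b′ ∷ as) a

  eval-const : ∀ a x → eval R (a ∷ []) x ≈ a
  eval-const a x = trans (+-congˡ (zeroʳ x)) (+-identityʳ a)

  HasDegree : ℕ → (Carrier → Carrier) → Set (c ⊔ ℓ)
  HasDegree D g = Σ (Vec Carrier (suc D)) λ p → ¬ leading p ≈ 0# × (∀ x → g x ≈ eval R p x)

  HasDegree-cong : ∀ {D g g′} → (∀ x → g′ x ≈ g x) → HasDegree D g → HasDegree D g′
  HasDegree-cong g′≈g (p , lead≉0 , g≈p) = p , lead≉0 , λ x → trans (g′≈g x) (g≈p x)

  HasDegree-const : ∀ {a} → ¬ a ≈ 0# → HasDegree 0 (λ _ → a)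
  HasDegree-const {a} a≉0 = (a ∷ []) , a≉0 , λ x → sym (eval-const a x)

  HasDegree-horner : ∀ {D g} a → HasDegree D g → HasDegree (suc D) (λ x → a + x * g x)
  HasDegree-horner a ((b ∷ p) , lead≉0 , g≈p) = (a ∷ b ∷ p) , lead≉0 , λ x → +-congˡ (*-congˡ (g≈p x))

  HasDegree-^* : ∀ {D g} t → HasDegree D g → HasDegree (t ℕ.+ D) (λ x → x ^ t * g x)
  HasDegree-^* zero    deg = HasDegree-cong (λ x → *-identityˡ _) deg
  HasDegree-^* (suc t) deg = HasDegree-cong (λ x → trans (*-assoc _ _ _) (sym (+-identityˡ _)))
                                            (HasDegree-horner 0# (HasDegree-^* t deg))

  geometric : Carrier → ℕ → Carrier → Carrier
  geometric c zero    y = 1#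
  geometric c (suc j) y = c ^ suc j + y * geometric c j y

  -- (y − c)(cʲ + cʲ⁻¹y + ⋯ + yʲ) = yʲ⁺¹ − cʲ⁺¹, arranged without subtraction.
  geometric-telescope : ∀ c j y → y * geometric c j y + c ^ suc j ≈ c * geometric c j y + y ^ suc j
  geometric-telescope c zero    y = +-comm _ _
  geometric-telescope c (suc j) y = begin
    y * (C + y * G) + c * C   ≈⟨ regroup₁ y c C G ⟩
    c * C + y * (y * G + C)   ≈⟨ +-congˡ (*-congˡ (geometric-telescope c j y)) ⟩
    c * C + y * (c * G + Y)   ≈⟨ regroup₂ y c C G Y ⟩
    c * (C + y * G) + y * Y   ∎
    where
    C G Y : Carrier
    C = c ^ suc j
    G = geometric c j y
    Y = y ^ suc j
    regroup₁ : ∀ y c C G → y * (C + y * G) + c * C ≈ c * C + y * (y * G + C)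
    regroup₁ = solve 4 (λ y c C G → (y ⊗ (C ⊕ y ⊗ G) ⊕ c ⊗ C) ⊜ (c ⊗ C ⊕ y ⊗ (y ⊗ G ⊕ C))) refl
    regroup₂ : ∀ y c C G Y → c * C + y * (c * G + Y) ≈ c * (C + y * G) + y * Y
    regroup₂ = solve 5 (λ y c C G Y → (c ⊗ C ⊕ y ⊗ (c ⊗ G ⊕ Y)) ⊜ (c ⊗ (C ⊕ y ⊗ G) ⊕ y ⊗ Y)) refl

  geometric-^-degree : ∀ c j t → HasDegree (j ℕ.* suc t) (λ x → geometric c j (x ^ suc t))
  geometric-^-degree c zero    t = HasDegree-const 1≉0
  geometric-^-degree c (suc j) t = HasDegree-cong (λ x → +-congˡ (*-assoc _ _ _))
    (HasDegree-horner (c ^ suc j) (HasDegree-^* t (geometric-^-degree c j t)))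

  ^-preserves-root : ∀ {x n} → x ^ n ≈ 1# → ∀ k → (x ^ k) ^ n ≈ 1#
  ^-preserves-root {x} {n} xⁿ≈1 k = trans (^-comm x k n) (trans (^-congˡ k xⁿ≈1) (1^n≈1 k))

  powers-distinct : ∀ {ε d a b} → HasOrder R ε d → a < b → b < d → ¬ ε ^ a ≈ ε ^ b
  powers-distinct {ε} {suc d} {a} {b} (εᵈ≈1 , minimal) a<b b<d εᵃ≈εᵇ =
    minimal (b ℕ.∸ a) (ℕ.m<n⇒0<n∸m a<b) (ℕ.≤-<-trans (ℕ.m∸n≤m b a) b<d)
      (sym (*-cancelˡ (^-nonzero a (root-of-unity-nonzero (suc d) εᵈ≈1)) (begin
        ε ^ a * 1#               ≈⟨ *-identityʳ _ ⟩
        ε ^ a                    ≈⟨ εᵃ≈εᵇ ⟩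
        ε ^ b                    ≡⟨ ≡.cong (ε ^_) (ℕ.m+[n∸m]≡n (ℕ.<⇒≤ a<b)) ⟨
        ε ^ (a ℕ.+ (b ℕ.∸ a))    ≈⟨ ^-homo-* ε a (b ℕ.∸ a) ⟩
        ε ^ a * ε ^ (b ℕ.∸ a)    ∎)))

  powers-injective : ∀ {ε d} → HasOrder R ε d → ∀ (i j : Fin d) → ε ^ toℕ i ≈ ε ^ toℕ j → i ≡ j
  powers-injective ε-order i j εⁱ≈εʲ with ℕ.<-cmp (toℕ i) (toℕ j)
  ... | tri< i<j _ _ = ⊥-elim (powers-distinct ε-order i<j (Fin.toℕ<n j) εⁱ≈εʲ)
  ... | tri≈ _ i≡j _ = Fin.toℕ-injective i≡j
  ... | tri> _ _ j<i = ⊥-elim (powers-distinct ε-order j<i (Fin.toℕ<n i) (sym εⁱ≈εʲ))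

  module Roots (≈-dec : Decidable₂ _≈_) where

    infix 4 _≟_
    _≟_ : Decidable₂ _≈_
    _≟_ = ≈-dec

    count-≈≤1 : ∀ a {s} (f : Fin s → Carrier) → Injective _≡_ _≈_ f → count (_≟ a) f ≤ 1
    count-≈≤1 a {zero}  f inj = z≤n
    count-≈≤1 a {suc s} f inj with f zero ≟ a
    ... | yes f0≈a = s≤s (ℕ.≤-reflexive (count-none (_≟ a) (f ∘ suc)
                           λ i fi≈a → Fin.0≢1+n (inj (trans f0≈a (sym fi≈a)))))
    ... | no  _    = count-≈≤1 a (f ∘ suc) (Fin.suc-injective ∘ inj)

    roots≤degree : ∀ {D g} → HasDegree D g → ∀ {s} (f : Fin s → Carrier) → Injective _≡_ _≈_ f →
                   count (λ x → g x ≟ 0#) f ≤ D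
    roots≤degree {zero} {g} ((a ∷ []) , a≉0 , g≈a) f inj =
      ℕ.≤-reflexive (count-none (λ x → g x ≟ 0#) f λ i gfi≈0 →
        a≉0 (trans (sym (eval-const a (f i))) (trans (sym (g≈a (f i))) gfi≈0)))
    roots≤degree {suc D} {g} (p , lead≉0 , g≈p) f inj with Fin.any? (λ i → g (f i) ≟ 0#)
    ... | no  rootless = ℕ.≤-trans (ℕ.≤-reflexive (count-none (λ x → g x ≟ 0#) f (λ i z → rootless (i , z)))) z≤n
    ... | yes (i , gfi≈0) = ℕ.≤-trans
          (count-⊆∪ (λ x → g x ≟ 0#) (_≟ a) (λ x → eval R q x ≟ 0#) f root-split)
          (ℕ.+-mono-≤ (count-≈≤1 a f inj) (roots≤degree q-degree f inj))
      where
      a : Carrier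
      a = f i
      q : Vec Carrier (suc D)
      q = quotient p a
      q-degree : HasDegree D (eval R q)
      q-degree = q , (λ lead≈0 → lead≉0 (trans (sym (leading-quotient p a)) lead≈0)) , λ x → refl
      root-split : ∀ {x} → g x ≈ 0# → x ≈ a ⊎ eval R q x ≈ 0#
      root-split {x} gx≈0 with eval R q x ≟ 0#
      ... | yes qx≈0 = inj₂ qx≈0
      ... | no  qx≉0 = inj₁ (*-cancelʳ qx≉0 (begin
        x * eval R q x                    ≈⟨ +-identityˡ _ ⟨
        0# + x * eval R q x               ≈⟨ +-congʳ (trans (sym gfi≈0) (g≈p a)) ⟩
        eval R p a + x * eval R q x       ≈⟨ quotient-correct p a x ⟨
        eval R p x + a * eval R q x       ≈⟨ +-congʳ (trans (sym (g≈p x)) gx≈0) ⟩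
        0# + a * eval R q x               ≈⟨ +-identityˡ _ ⟩
        a * eval R q x                    ∎))

    ^≈^⇒≈⊎geometric≈0 : ∀ {y c} j → y ^ suc j ≈ c ^ suc j → y ≈ c ⊎ geometric c j y ≈ 0#
    ^≈^⇒≈⊎geometric≈0 {y} {c} j yʲ≈cʲ with geometric c j y ≟ 0#
    ... | yes G≈0 = inj₂ G≈0
    ... | no  G≉0 = inj₁ (*-cancelʳ G≉0 (+-cancelʳ (c ^ suc j) _ _ (begin
      y * G + c ^ suc j  ≈⟨ geometric-telescope c j y ⟩
      c * G + y ^ suc j  ≈⟨ +-congˡ yʲ≈cʲ ⟩
      c * G + c ^ suc j  ∎)))
      where
      G : Carrier
      G = geometric c j y

    -- xᴹ − 1 = (xᵗ − c)·g(xᵗ) with deg g(xᵗ) = M − t, so at most M − t roots of xᴹ − 1 miss xᵗ = c.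
    xᵗ≈c-has-t-solutions : ∀ {s} (f : Fin s → Carrier) → Injective _≡_ _≈_ f →
               ∀ t j .{{_ : NonZero t}} .{{_ : NonZero j}} {M : ℕ} {c : Carrier} →
               t ℕ.* j ≡ M → c ^ j ≈ 1# → M ≤ count (λ x → x ^ M ≟ 1#) f → t ≤ count (λ x → x ^ t ≟ c) f
    xᵗ≈c-has-t-solutions f inj (suc t) (suc j) {M} {c} tj≡M cʲ≈1 M≤roots =
      ℕ.+-cancelʳ-≤ (j ℕ.* suc t) (suc t) _
        (ℕ.≤-trans (ℕ.≤-reflexive t+jt≡M)
        (ℕ.≤-trans M≤roots
        (ℕ.≤-trans (count-⊆∪ (λ x → x ^ M ≟ 1#) (λ x → x ^ suc t ≟ c) (λ x → G x ≟ 0#) f root-split)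
                   (ℕ.+-monoʳ-≤ _ (roots≤degree (geometric-^-degree c j t) f inj)))))
      where
      t+jt≡M : suc t ℕ.+ j ℕ.* suc t ≡ M
      t+jt≡M = ≡.trans (≡.cong (suc t ℕ.+_) (ℕ.*-comm j (suc t))) (≡.trans (≡.sym (ℕ.*-suc (suc t) j)) tj≡M)
      G : Carrier → Carrier
      G x = geometric c j (x ^ suc t)
      root-split : ∀ {x} → x ^ M ≈ 1# → x ^ suc t ≈ c ⊎ G x ≈ 0#
      root-split {x} xᴹ≈1 = ^≈^⇒≈⊎geometric≈0 j
        (trans (^-assocʳ x (suc t) (suc j)) (trans (^-congʳ x tj≡M) (trans xᴹ≈1 (sym cʲ≈1))))

    -- y, 1, ε, …, εᵈ⁻¹ would be d + 1 distinct roots of Xᵈ − 1.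
    roots-are-powers : ∀ {ε} d .{{_ : NonZero d}} → HasOrder R ε d →
                       ∀ {y} → y ^ d ≈ 1# → ∃ λ (k : Fin d) → y ≈ ε ^ toℕ k
    roots-are-powers {ε} (suc d) ε-order {y} yᵈ≈1 with Fin.any? (λ k → y ≟ ε ^ toℕ k)
    ... | yes found = found
    ... | no  ¬found = ⊥-elim (ℕ.1+n≰n (≡.subst (_≤ suc d)
        (count-all (λ x → G x ≟ 0#) candidate candidates-are-roots)
        (roots≤degree G-degree candidate candidate-injective)))
      where
      G : Carrier → Carrier
      G x = - 1# + x * (x ^ d * 1#)
      G-degree : HasDegree (suc d) G
      G-degree = ≡.subst (λ D → HasDegree (suc D) G) (ℕ.+-identityʳ d)
                         (HasDegree-horner (- 1#) (HasDegree-^* d (HasDegree-const 1≉0)))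
      root⇒G≈0 : ∀ {x} → x ^ suc d ≈ 1# → G x ≈ 0#
      root⇒G≈0 xᵈ≈1 = trans (+-congˡ (trans (*-congˡ (*-identityʳ _)) xᵈ≈1)) (-‿inverseˡ 1#)
      candidate : Fin (suc (suc d)) → Carrier
      candidate zero    = y
      candidate (suc k) = ε ^ toℕ k
      candidates-are-roots : ∀ i → G (candidate i) ≈ 0#
      candidates-are-roots zero    = root⇒G≈0 yᵈ≈1
      candidates-are-roots (suc k) = root⇒G≈0 (^-preserves-root {ε} {suc d} (proj₁ ε-order) (toℕ k))
      candidate-injective : Injective _≡_ _≈_ candidate
      candidate-injective {zero}  {zero}  _   = ≡.refl
      candidate-injective {zero}  {suc k} y≈εᵏ = ⊥-elim (¬found (k , y≈εᵏ))
      candidate-injective {suc k} {zero}  εᵏ≈y = ⊥-elim (¬found (k , sym εᵏ≈y))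
      candidate-injective {suc k} {suc l} εᵏ≈εˡ = ≡.cong suc (powers-injective ε-order k l εᵏ≈εˡ)

  -- Finite fields

  module Finite {N : ℕ} (card : HasCard R N) where

    enumerate : Fin N → Carrier
    enumerate = proj₁ card

    enumerate-injective : Injective _≡_ _≈_ enumerate
    enumerate-injective = proj₁ (proj₂ card) _ _

    index : Carrier → Fin N
    index x = proj₁ (proj₂ (proj₂ card) x)

    enumerate-index : ∀ x → enumerate (index x) ≈ x
    enumerate-index x = proj₂ (proj₂ (proj₂ card) x)

    index-injective : ∀ {x y} → index x ≡ index y → x ≈ y
    index-injective {x} {y} eq = trans (sym (enumerate-index x)) (trans (reflexive (≡.cong enumerate eq)) (enumerate-index y))

    index-cong : ∀ {x y} → x ≈ y → index x ≡ index y
    index-cong {x} {y} x≈y = enumerate-injective (trans (enumerate-index x) (trans x≈y (sym (enumerate-index y))))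

    ≈-dec : Decidable₂ _≈_
    ≈-dec x y with index x Fin.≟ index y
    ... | yes eq = yes (index-injective eq)
    ... | no  ne = no (ne ∘ index-cong)

    open Roots ≈-dec public

    #units : ℕ
    #units = count (∁? (_≟ 0#)) enumerate

    1+#units≡N : suc #units ≡ N
    1+#units≡N = ≡.trans (≡.cong (ℕ._+ #units) (≡.sym #zeros≡1)) (count-complement (_≟ 0#) enumerate)
      where
      #zeros≡1 : count (_≟ 0#) enumerate ≡ 1
      #zeros≡1 = ℕ.≤-antisym (count-≈≤1 0# enumerate enumerate-injective)
                             (∃⇒0<count (_≟ 0#) enumerate (index 0#) (enumerate-index 0#))

    open import Algebra.Properties.CommutativeMonoid.Sum *-commutativeMonoid
      using () renaming (sum to ∏; sum-permute to ∏-permute; sum-cong-≋ to ∏-cong)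

    unit-part : Carrier → Carrier
    unit-part y with y ≟ 0#
    ... | yes _ = 1#
    ... | no  _ = y

    unit-part-nonzero : ∀ y → ¬ unit-part y ≈ 0#
    unit-part-nonzero y with y ≟ 0#
    ... | yes _   = 1≉0
    ... | no  y≉0 = y≉0

    unit-part-cong : ∀ {y y′} → y ≈ y′ → unit-part y ≈ unit-part y′
    unit-part-cong {y} {y′} y≈y′ with y ≟ 0# | y′ ≟ 0#
    ... | yes _    | yes _     = refl
    ... | yes y≈0  | no  y′≉0  = ⊥-elim (y′≉0 (trans (sym y≈y′) y≈0))
    ... | no  y≉0  | yes y′≈0  = ⊥-elim (y≉0 (trans y≈y′ y′≈0))
    ... | no  _    | no  _     = y≈y′

    ∏-nonzero : ∀ {s} (f : Fin s → Carrier) → (∀ i → ¬ f i ≈ 0#) → ¬ ∏ f ≈ 0#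
    ∏-nonzero {zero}  f f≉0 = 1≉0
    ∏-nonzero {suc s} f f≉0 = *-nonzero (f≉0 zero) (∏-nonzero (f ∘ suc) (f≉0 ∘ suc))

    module _ {x} (x≉0 : ¬ x ≈ 0#) where

      unit-part-*-zero : ∀ {y} → y ≈ 0# → unit-part (x * y) ≈ 1#
      unit-part-*-zero {y} y≈0 with x * y ≟ 0#
      ... | yes _    = refl
      ... | no  xy≉0 = ⊥-elim (xy≉0 (trans (*-congˡ y≈0) (zeroʳ x)))

      unit-part-*-unit : ∀ {y} → ¬ y ≈ 0# → unit-part (x * y) ≈ x * y
      unit-part-*-unit {y} y≉0 with x * y ≟ 0#
      ... | yes xy≈0 = ⊥-elim (*-nonzero x≉0 y≉0 xy≈0)
      ... | no  _    = refl

      ∏-unit-part-* : ∀ {s} (f : Fin s → Carrier) →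
                      ∏ (λ i → unit-part (x * f i)) ≈ x ^ count (∁? (_≟ 0#)) f * ∏ (unit-part ∘ f)
      ∏-unit-part-* {zero}  f = sym (*-identityʳ 1#)
      ∏-unit-part-* {suc s} f with f zero ≟ 0#
      ... | yes f₀≈0 = trans (*-cong (unit-part-*-zero f₀≈0) (∏-unit-part-* (f ∘ suc))) (x∙yz≈y∙xz _ _ _)
      ... | no  f₀≉0 = trans (*-cong (unit-part-*-unit f₀≉0) (∏-unit-part-* (f ∘ suc))) (interchange _ _ _ _)

      scaling : Permutation N N
      scaling = mk↔ₛ′ (λ i → index (x * enumerate i)) (λ i → index (inv x * enumerate i))
                      (λ i → enumerate-injective (cancel (inverse x x≉0) i))
                      (λ i → enumerate-injective (cancel (inverseˡ x x≉0) i))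
        where
        cancel : ∀ {a b} → a * b ≈ 1# → ∀ i →
                 enumerate (index (a * enumerate (index (b * enumerate i)))) ≈ enumerate i
        cancel {a} {b} ab≈1 i = begin
          enumerate (index (a * enumerate (index (b * enumerate i))))  ≈⟨ enumerate-index _ ⟩
          a * enumerate (index (b * enumerate i))                      ≈⟨ *-congˡ (enumerate-index _) ⟩
          a * (b * enumerate i)                                        ≈⟨ *-assoc _ _ _ ⟨
          (a * b) * enumerate i                                        ≈⟨ *-congʳ ab≈1 ⟩
          1# * enumerate i                                             ≈⟨ *-identityˡ _ ⟩
          enumerate i                                                  ∎

      -- Multiplication by x permutes the field and fixes 0, so it leaves the product of all
      -- unit parts unchanged while pulling out one factor x per unit.
      fermat : x ^ #units ≈ 1#
      fermat = *-cancelʳ (∏-nonzero (unit-part ∘ enumerate) (unit-part-nonzero ∘ enumerate)) (sym (begin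
        1# * P                                                     ≈⟨ *-identityˡ P ⟩
        P                                                          ≈⟨ ∏-permute (unit-part ∘ enumerate) scaling ⟩
        ∏ (λ i → unit-part (enumerate (index (x * enumerate i))))
          ≈⟨ ∏-cong (λ i → unit-part-cong (enumerate-index (x * enumerate i))) ⟩
        ∏ (λ i → unit-part (x * enumerate i))                      ≈⟨ ∏-unit-part-* enumerate ⟩
        x ^ #units * P                                             ∎))
        where
        P : Carrier
        P = ∏ (unit-part ∘ enumerate)

    0<#units : 0 < #units
    0<#units = ∃⇒0<count (∁? (_≟ 0#)) enumerate (index 1#) (1≉0 ∘ trans (sym (enumerate-index 1#)))

    #units≤#roots-of-unity : #units ≤ count (λ x → x ^ #units ≟ 1#) enumerate
    #units≤#roots-of-unity = count-mono (∁? (_≟ 0#)) (λ x → x ^ #units ≟ 1#) enumerate fermat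

    xᵗ≈1-has-t-solutions : ∀ t .{{_ : NonZero t}} → t ∣ #units → t ≤ count (λ x → x ^ t ≟ 1#) enumerate
    xᵗ≈1-has-t-solutions t (divides zero #units≡0) = ⊥-elim (ℕ.<⇒≢ 0<#units (≡.sym #units≡0))
    xᵗ≈1-has-t-solutions t (divides k@(suc _) #units≡kt) =
      xᵗ≈c-has-t-solutions enumerate enumerate-injective t k (≡.trans (ℕ.*-comm t k) (≡.sym #units≡kt))
                           (1^n≈1 k) #units≤#roots-of-unity

    ∃-mth-root : ∀ m d .{{_ : NonZero m}} .{{_ : NonZero d}} {c} →
                 m ℕ.* d ∣ #units → c ^ d ≈ 1# → ∃ λ a → a ^ m ≈ c
    ∃-mth-root m d {c} md∣#units cᵈ≈1 =
      map enumerate id (0<count⇒∃ (λ x → x ^ m ≟ c) enumerate (ℕ.<-≤-trans (ℕ.>-nonZero⁻¹ m)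
        (xᵗ≈c-has-t-solutions enumerate enumerate-injective m d ≡.refl cᵈ≈1
                  (xᵗ≈1-has-t-solutions (m ℕ.* d) {{ℕ.m*n≢0 m d}} md∣#units))))

    ∃-nontrivial-root : ∀ g → 1 < g → g ∣ #units → ∃ λ z → z ^ g ≈ 1# × ¬ z ≈ 1#
    ∃-nontrivial-root g 1<g@(s≤s (s≤s _)) g∣#units =
      map enumerate id (0<count⇒∃ (Root? ∩? ∁? (_≟ 1#)) enumerate (ℕ.+-cancelˡ-≤ 1 1 _
        (ℕ.≤-trans 1<g (ℕ.≤-trans (xᵗ≈1-has-t-solutions g g∣#units)
        (ℕ.≤-trans (count-⊆∪ Root? (_≟ 1#) (Root? ∩? ∁? (_≟ 1#)) enumerate split)
                   (ℕ.+-monoˡ-≤ _ (count-≈≤1 1# enumerate enumerate-injective)))))))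
      where
      Root? : Decidable (λ x → x ^ g ≈ 1#)
      Root? x = x ^ g ≟ 1#
      split : ∀ {x} → x ^ g ≈ 1# → x ≈ 1# ⊎ (x ^ g ≈ 1# × ¬ x ≈ 1#)
      split {x} xᵍ≈1 with x ≟ 1#
      ... | yes x≈1 = inj₁ x≈1
      ... | no  x≉1 = inj₂ (xᵍ≈1 , x≉1)

    module _ {p} {P : Pred Carrier p} (P? : Decidable P) (P-resp : ∀ {x y} → x ≈ y → P x → P y)
             (φ : Carrier → Carrier) (φ-into : ∀ x → P x → P (φ x))
             (φ-injective : ∀ x y → P x → P y → φ x ≈ φ y → x ≈ y) where

      extension : Carrier → Carrier
      extension x with P? x
      ... | yes _ = φ x
      ... | no  _ = x

      extension-injective : Injective _≡_ _≡_ (index ∘ extension ∘ enumerate)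
      extension-injective {i} {j} eq with P? (enumerate i) | P? (enumerate j)
      ... | yes pᵢ | yes pⱼ = enumerate-injective (φ-injective _ _ pᵢ pⱼ (index-injective eq))
      ... | yes pᵢ | no ¬pⱼ = ⊥-elim (¬pⱼ (P-resp (index-injective eq) (φ-into _ pᵢ)))
      ... | no ¬pᵢ | yes pⱼ = ⊥-elim (¬pᵢ (P-resp (sym (index-injective eq)) (φ-into _ pⱼ)))
      ... | no  _  | no  _  = enumerate-injective (index-injective eq)

      injectiveOn⇒surjectiveOn : ∀ y → P y → ∃ λ x → P x × φ x ≈ y
      injectiveOn⇒surjectiveOn y py
        with i , eq ← Fin-injective⇒surjective _ extension-injective (index y)
        with P? (enumerate i)
      ... | yes pᵢ = enumerate i , pᵢ , index-injective eq
      ... | no ¬pᵢ = ⊥-elim (¬pᵢ (P-resp (sym (index-injective eq)) py))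

  -- The permutation criterion

  module Criterion {N : ℕ} (card : HasCard R N) (q : ℕ) (q+1∣#units : suc q ∣ Finite.#units card)
                   (m d : ℕ) .{{_ : NonZero m}} .{{_ : NonZero d}} (m*d≡q+1 : m ℕ.* d ≡ suc q)
                   {ε : Carrier} (ε-order : HasOrder R ε d) where

    open Finite card

    μ : Pred Carrier ℓ
    μ = InMu R q

    μ-resp : ∀ {x y} → x ≈ y → μ x → μ y
    μ-resp x≈y μx = trans (^-congˡ (suc q) (sym x≈y)) μx

    μ-nonzero : ∀ {x} → μ x → ¬ x ≈ 0#
    μ-nonzero = root-of-unity-nonzero (suc q)

    m∣q+1 : m ∣ suc q
    m∣q+1 = divides d (≡.trans (≡.sym m*d≡q+1) (ℕ.*-comm m d))

    d∣q+1 : d ∣ suc q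
    d∣q+1 = divides m (≡.sym m*d≡q+1)

    εᵏ-root : ∀ k → (ε ^ k) ^ d ≈ 1#
    εᵏ-root = ^-preserves-root {ε} {d} (proj₁ ε-order)

    ^m-root⇒μ : ∀ {x} → (x ^ m) ^ d ≈ 1# → μ x
    ^m-root⇒μ {x} xᵐᵈ≈1 = trans (^-congʳ x (≡.sym m*d≡q+1)) (trans (sym (^-assocʳ x m d)) xᵐᵈ≈1)

    coset : ∀ {x} → μ x → ∃ λ (k : Fin d) → x ^ m ≈ ε ^ toℕ k
    coset {x} μx = roots-are-powers d ε-order (trans (^-assocʳ x m d) (trans (^-congʳ x m*d≡q+1) μx))

    coset-inhabited : ∀ (k : Fin d) → ∃ λ a → μ a × a ^ m ≈ ε ^ toℕ k
    coset-inhabited k =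
      map id (λ aᵐ≈εᵏ → ^m-root⇒μ (trans (^-congˡ d aᵐ≈εᵏ) (εᵏ-root (toℕ k))) , aᵐ≈εᵏ)
        (∃-mth-root m d (≡.subst (_∣ #units) (≡.sym m*d≡q+1) q+1∣#units) (εᵏ-root (toℕ k)))

    module _ (f : Carrier → Carrier) (e : Fin d → ℤ) (lam : Fin d → Carrier) (π : Fin d → Fin d)
             (lam∈μ : ∀ k → μ (lam k)) (lam-coset : ∀ k → lam k ^ m ≈ ε ^ toℕ (π k))
             (f-on-coset : ∀ k x → μ x → x ^ m ≈ ε ^ toℕ k → f x ≈ lam k * x ^ℤ e k) where

      σ : Fin d → Fin d
      σ k = modFin (+ toℕ (π k) ℤ.+ e k ℤ.* + toℕ k) d

      σ-exponent : ∀ k → + (toℕ (π k) ℕ.+ toℕ k ℕ.* (e k %ℕ suc q)) ≡ + toℕ (σ k) mod d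
      σ-exponent k = ≡.subst₂ (_≡_mod d) (≡.sym pos-exponent) (≡.cong +_ (≡.sym (Fin.toℕ-fromℕ< _)))
        (mod-trans (mod-affine (+ p) (+ κ) (mod-divisor d∣q+1 (%ℕ-mod (e k) (suc q))))
                   (%ℕ-mod (+ p ℤ.+ e k ℤ.* + κ) d))
        where
        p κ E : ℕ
        p = toℕ (π k)
        κ = toℕ k
        E = e k %ℕ suc q
        pos-exponent : + (p ℕ.+ κ ℕ.* E) ≡ + p ℤ.+ + κ ℤ.* + E
        pos-exponent = ≡.trans (ℤ.pos-+ p (κ ℕ.* E)) (≡.cong (λ z → + p ℤ.+ z) (ℤ.pos-* κ E))

      f-on-coset-ℕ : ∀ k x → μ x → x ^ m ≈ ε ^ toℕ k → f x ≈ lam k * x ^ (e k %ℕ suc q)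
      f-on-coset-ℕ k x μx xᵐ≈εᵏ =
        trans (f-on-coset k x μx xᵐ≈εᵏ) (*-congˡ (^ℤ-mod μx (μ-nonzero μx) (%ℕ-mod (e k) (suc q))))

      f-maps-coset : ∀ k x → μ x → x ^ m ≈ ε ^ toℕ k → μ (f x) × f x ^ m ≈ ε ^ toℕ (σ k)
      f-maps-coset k x μx xᵐ≈εᵏ = μ-resp (sym fx≈) (begin
          (lam k * x ^ E) ^ suc q          ≈⟨ ^-distrib-* (lam k) (x ^ E) (suc q) ⟩
          lam k ^ suc q * (x ^ E) ^ suc q  ≈⟨ *-cong (lam∈μ k) (^-preserves-root {x} {suc q} μx E) ⟩
          1# * 1#                          ≈⟨ *-identityˡ 1# ⟩
          1#                               ∎)
        , (begin
          f x ^ m                          ≈⟨ ^-congˡ m fx≈ ⟩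
          (lam k * x ^ E) ^ m              ≈⟨ ^-distrib-* (lam k) (x ^ E) m ⟩
          lam k ^ m * (x ^ E) ^ m          ≈⟨ *-cong (lam-coset k) (^-comm x E m) ⟩
          ε ^ p * (x ^ m) ^ E              ≈⟨ *-congˡ (^-congˡ E xᵐ≈εᵏ) ⟩
          ε ^ p * (ε ^ κ) ^ E              ≈⟨ *-congˡ (^-assocʳ ε κ E) ⟩
          ε ^ p * ε ^ (κ ℕ.* E)            ≈⟨ ^-homo-* ε p (κ ℕ.* E) ⟨
          ε ^ (p ℕ.+ κ ℕ.* E)              ≈⟨ ^-cong-mod (proj₁ ε-order) _ _ (σ-exponent k) ⟩
          ε ^ toℕ (σ k)                ∎)
        where
        E p κ : ℕ
        E = e k %ℕ suc q
        p = toℕ (π k)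
        κ = toℕ k
        fx≈ : f x ≈ lam k * x ^ E
        fx≈ = f-on-coset-ℕ k x μx xᵐ≈εᵏ

      f-maps-μ : ∀ x → μ x → μ (f x)
      f-maps-μ x μx with k , xᵐ≈εᵏ ← coset μx = proj₁ (f-maps-coset k x μx xᵐ≈εᵏ)

      module _ (e-coprime : ∀ k → ℕ.gcd ℤ.∣ e k ∣ m ≡ 1) (σ-injective : Injective _≡_ _≡_ σ) where

        same-coset : ∀ {k l x y} → μ x → μ y → x ^ m ≈ ε ^ toℕ k → y ^ m ≈ ε ^ toℕ l →
                     f x ≈ f y → k ≡ l
        same-coset {k} {l} {x} {y} μx μy xᵐ≈εᵏ yᵐ≈εˡ fx≈fy =
          σ-injective (powers-injective ε-order (σ k) (σ l) (begin
          ε ^ toℕ (σ k)  ≈⟨ proj₂ (f-maps-coset k x μx xᵐ≈εᵏ) ⟨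
          f x ^ m            ≈⟨ ^-congˡ m fx≈fy ⟩
          f y ^ m            ≈⟨ proj₂ (f-maps-coset l y μy yᵐ≈εˡ) ⟩
          ε ^ toℕ (σ l)  ∎))

        f-injective-on-coset : ∀ k {x y} → μ x → μ y → x ^ m ≈ ε ^ toℕ k → y ^ m ≈ ε ^ toℕ k →
                               f x ≈ f y → x ≈ y
        f-injective-on-coset k {x} {y} μx μy xᵐ≈εᵏ yᵐ≈εᵏ fx≈fy =
          ^-≈-coprime⇒≈ ℤ.∣ e k ∣ m (μ-nonzero μx) xᵉ≈yᵉ (trans xᵐ≈εᵏ (sym yᵐ≈εᵏ)) (e-coprime k)
          where
          xᵉ≈yᵉ : x ^ ℤ.∣ e k ∣ ≈ y ^ ℤ.∣ e k ∣
          xᵉ≈yᵉ = ^ℤ≈⇒^∣∣≈ (μ-nonzero μx) (μ-nonzero μy) (e k)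
                    (*-cancelˡ (μ-nonzero (lam∈μ k))
                      (trans (sym (f-on-coset k x μx xᵐ≈εᵏ)) (trans fx≈fy (f-on-coset k y μy yᵐ≈εᵏ))))

        f-injective : ∀ x y → μ x → μ y → f x ≈ f y → x ≈ y
        f-injective x y μx μy fx≈fy =
          let k , xᵐ≈εᵏ = coset μx
              l , yᵐ≈εˡ = coset μy
          in f-injective-on-coset k μx μy xᵐ≈εᵏ
               (≡.subst (λ j → y ^ m ≈ ε ^ toℕ j) (≡.sym (same-coset {k} {l} μx μy xᵐ≈εᵏ yᵐ≈εˡ fx≈fy)) yᵐ≈εˡ)
               fx≈fy

        f-permutes : Permutes R q f
        f-permutes = f-maps-μ , f-injective ,
                     injectiveOn⇒surjectiveOn (λ x → x ^ suc q ≟ 1#) μ-resp f f-maps-μ f-injective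

      module _ (f-permutes : Permutes R q f) where

        common-root≈1 : ∀ k {g a z} .{{_ : NonZero g}} → g ∣ ℤ.∣ e k ∣ → g ∣ m → z ^ g ≈ 1# →
                        μ a → a ^ m ≈ ε ^ toℕ k → z ≈ 1#
        common-root≈1 k {g} {a} {z} g∣e g∣m zᵍ≈1 μa aᵐ≈εᵏ =
          *-cancelˡ (μ-nonzero μa) (trans (proj₁ (proj₂ f-permutes) (a * z) a μaz μa faz≈fa) (sym (*-identityʳ a)))
          where
          z≉0 : ¬ z ≈ 0#
          z≉0 = root-of-unity-nonzero g zᵍ≈1
          zᵉ≈1 : z ^ℤ e k ≈ 1#
          zᵉ≈1 = ^∣∣≈1⇒^ℤ≈1 z≉0 (e k) (^≈1⇒^-multiple≈1 zᵍ≈1 g∣e)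
          μaz : μ (a * z)
          μaz = trans (^-distrib-* a z (suc q))
                  (trans (*-cong μa (^≈1⇒^-multiple≈1 zᵍ≈1 (∣-trans g∣m m∣q+1))) (*-identityˡ 1#))
          azᵐ≈εᵏ : (a * z) ^ m ≈ ε ^ toℕ k
          azᵐ≈εᵏ = trans (^-distrib-* a z m)
                     (trans (*-cong aᵐ≈εᵏ (^≈1⇒^-multiple≈1 zᵍ≈1 g∣m)) (*-identityʳ _))
          faz≈fa : f (a * z) ≈ f a
          faz≈fa = begin
            f (a * z)                       ≈⟨ f-on-coset k (a * z) μaz azᵐ≈εᵏ ⟩
            lam k * (a * z) ^ℤ e k          ≈⟨ *-congˡ (^ℤ-distrib-* (μ-nonzero μa) z≉0 (e k)) ⟩
            lam k * (a ^ℤ e k * z ^ℤ e k)   ≈⟨ *-congˡ (*-congˡ zᵉ≈1) ⟩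
            lam k * (a ^ℤ e k * 1#)         ≈⟨ *-congˡ (*-identityʳ _) ⟩
            lam k * a ^ℤ e k                ≈⟨ f-on-coset k a μa aᵐ≈εᵏ ⟨
            f a                             ∎

        ¬1<gcd : ∀ k → ¬ 1 < ℕ.gcd ℤ.∣ e k ∣ m
        ¬1<gcd k 1<g
          with z , zᵍ≈1 , z≉1 ← ∃-nontrivial-root _ 1<g
                                  (∣-trans (ℕ.gcd[m,n]∣n ℤ.∣ e k ∣ m) (∣-trans m∣q+1 q+1∣#units))
             | a , μa , aᵐ≈εᵏ ← coset-inhabited k
          = z≉1 (common-root≈1 k {{ℕ.>-nonZero (ℕ.<-trans ℕ.z<s 1<g)}}
                   (ℕ.gcd[m,n]∣m ℤ.∣ e k ∣ m) (ℕ.gcd[m,n]∣n ℤ.∣ e k ∣ m) zᵍ≈1 μa aᵐ≈εᵏ)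

        e-coprime : ∀ k → ℕ.gcd ℤ.∣ e k ∣ m ≡ 1
        e-coprime k = ℕ.≤-antisym (ℕ.≮⇒≥ (¬1<gcd k))
                        (ℕ.n≢0⇒n>0 (ℕ.≢-nonZero⁻¹ m ∘ ℕ.gcd[m,n]≡0⇒n≡0 ℤ.∣ e k ∣))

        σ-surjective : StrictlySurjective _≡_ σ
        σ-surjective j
          with a , μa , aᵐ≈εʲ ← coset-inhabited j
          with x , μx , fx≈a ← proj₂ (proj₂ f-permutes) a μa
          with k , xᵐ≈εᵏ ← coset μx
          = k , powers-injective ε-order (σ k) j (begin
              ε ^ toℕ (σ k)  ≈⟨ proj₂ (f-maps-coset k x μx xᵐ≈εᵏ) ⟨
              f x ^ m        ≈⟨ ^-congˡ m fx≈a ⟩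
              a ^ m          ≈⟨ aᵐ≈εʲ ⟩
              ε ^ toℕ j      ∎)

      criterion : Permutes R q f ⇔ ((∀ k → gcd (e k) (+ m) ≡ 1ℤ) × Bijective _≡_ _≡_ σ)
      criterion = mk⇔ necessary sufficient
        where
        necessary : Permutes R q f → (∀ k → gcd (e k) (+ m) ≡ 1ℤ) × Bijective _≡_ _≡_ σ
        necessary f-permutes = (λ k → ≡.cong +_ (e-coprime f-permutes k))
                             , Fin-surjective⇒injective σ (σ-surjective f-permutes)
                             , strictlySurjective⇒surjective (σ-surjective f-permutes)
        sufficient : (∀ k → gcd (e k) (+ m) ≡ 1ℤ) × Bijective _≡_ _≡_ σ → Permutes R q f
        sufficient (coprime , σ-injective , _) = f-permutes (λ k → ℤ.+-injective (coprime k)) σ-injective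

q+1∣q²-1 : ∀ q {u} → suc u ≡ q ℕ.* q → suc q ∣ u
q+1∣q²-1 (suc q) 1+u≡q² = divides q (ℕ.suc-injective (≡.trans 1+u≡q² (square q)))
  where
  square : ∀ q → suc q ℕ.* suc q ≡ suc (q ℕ.* suc (suc q))
  square = solveℕ-∀

open import Data.Nat using (_*_)

-- Only the coset description of x ↦ xʳ h(x)^(q−1) is used: that q is a prime power, 1 ≤ r
-- and the particular shape of the map play no further role.
theorem1p1 : {c ℓ : Level} (R : CommutativeRing c ℓ) (F : IsField R)
  (q : ℕ) → IsPrimePower q → HasCard R (q * q) →
  (r : ℕ) → 1 ≤ r →
  (d : ℕ) .{{_ : NonZero d}} → d ∣ suc q →
  (ε : CommutativeRing.Carrier R) → HasOrder R ε d →
  (h : Vec (CommutativeRing.Carrier R) (suc q)) →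
  (e : Fin d → ℤ) (lam : Fin d → CommutativeRing.Carrier R) (π : Fin d → Fin d) →
  (∀ k → InMu R q (lam k)) →
  (∀ k → CommutativeRing._≈_ R (pow R (lam k) (suc q / d)) (pow R ε (toℕ (π k)))) →
  (∀ k x → InMu R q x → CommutativeRing._≈_ R (pow R x (suc q / d)) (pow R ε (toℕ k)) →
     CommutativeRing._≈_ R
       (CommutativeRing._*_ R (pow R x r) (pow R (eval R h x) (q ∸ 1)))
       (CommutativeRing._*_ R (lam k) (zpow R F x (e k)))) →
  Permutes R q (λ x → CommutativeRing._*_ R (pow R x r) (pow R (eval R h x) (q ∸ 1)))
  ⇔ ((∀ k → gcd (e k) (+ (suc q / d)) ≡ 1ℤ)
     × Bijective _≡_ _≡_ (λ k → modFin (ℤ._+_ (+ toℕ (π k)) (ℤ._*_ (e k) (+ toℕ k))) d))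
theorem1p1 R F q _ card r _ d d∣q+1 ε ε-order h e lam π lam∈μ lam-coset f-on-coset =
  criterion (λ x → CommutativeRing._*_ R (pow R x r) (pow R (eval R h x) (q ∸ 1)))
            e lam π lam∈μ lam-coset f-on-coset
  where
  m*d≡q+1 : suc q / d * d ≡ suc q
  m*d≡q+1 = m/n*n≡m d∣q+1
  instance
    m≢0 : NonZero (suc q / d)
    m≢0 = ℕ.m*n≢0⇒m≢0 (suc q / d) {{≡.subst NonZero (≡.sym m*d≡q+1) _}}
  open Field R F using (module Finite; module Criterion)
  open Criterion card q (q+1∣q²-1 q (Finite.1+#units≡N card)) (suc q / d) d m*d≡q+1 ε-order
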